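{- Let $A=\mathbb{Z}[\rho]$ with $\rho=e^{2\pi i/6}$, let $f$ be an integral binary hermitian form over $\mathbb{Q}(\sqrt{ -3})$ of discriminant $\Delta$, and let $(\mathbf u,\mathbf v)$ be a basis of $A^2$ (a 2-cell $\sigma$ of the spine, a hexagon whose vertices $v_0,\dots,v_5$ correspond to the ultrabases $\{\mathbf u,\mathbf v,\mathbf u+\rho^j\mathbf v,\mathbf u+\rho^{j+1}\mathbf v\}$). For $j=0,\dots,5$ let $$inv(v_j)=f(\mathbf u)+f(\mathbf v)+f(\mathbf u+\rho^j\mathbf v)+f(\mathbf u+\rho^{j+1}\mathbf v).$$ Identifying $v_j$ with $\rho^j\in\mathbb{C}$ (so $\sigma$ is identified with the convex hull of the $\rho^j$), there is an affine function $L:\mathbb{C}\to\mathbb{R}$ with $L(\rho^j)=inv(v_j)$ for all $j$. Moreover, if $3$ does not divide $\Delta$, then $L$ is not constant on any edge of $\sigma$, i.e. $inv(v_j)\neq inv(v_{j+1})$ for all $j$ (indices mod $6$).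
   Context: $N(x)=|x|^2$. A binary hermitian form over $\mathbb{Q}(\sqrt{ -3})$ is $f(x,y)=aN(x)+cN(y)+\nu x\bar y+\bar\nu\bar xy$ with $a,c\in\mathbb{Q}$, $\nu\in\mathbb{Q}(\sqrt{ -3})$; integral means $f(A^2)\subseteq\mathbb{Z}$. The discriminant is $\Delta=-3(ac-N(\nu))$ computed from the matrix of $f$ in a basis of $A^2$ (an integer independent of that basis). -}

module Defs where

open import Data.Nat using (ℕ; zero; suc)
open import Data.Integer as ℤ using (ℤ; +_)
open import Data.Rational as ℚ using (ℚ; _/_)
open import Data.Product using (_×_; _,_; proj₁; proj₂; ∃; ∃-syntax)
open import Relation.Binary.PropositionalEquality using (_≡_)

-- The ring A = ℤ[ρ], ρ = e^{2πi/6}, ρ² = ρ - 1.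
-- An element m + nρ is represented by the pair (m , n).

A : Set
A = ℤ × ℤ

_+A_ : A → A → A
(a , b) +A (c , d) = (a ℤ.+ c , b ℤ.+ d)

-- (a + bρ)(c + dρ) = (ac - bd) + (ad + bc + bd)ρ
_*A_ : A → A → A
(a , b) *A (c , d) = (a ℤ.* c ℤ.- b ℤ.* d , a ℤ.* d ℤ.+ b ℤ.* c ℤ.+ b ℤ.* d)

0A 1A ρA : A
0A = (+ 0 , + 0)
1A = (+ 1 , + 0)
ρA = (+ 0 , + 1)

ρ^ : ℕ → A
ρ^ zero    = 1A
ρ^ (suc j) = ρA *A ρ^ j

A² : Set
A² = A × A

_+V_ : A² → A² → A²
(x₁ , x₂) +V (y₁ , y₂) = (x₁ +A y₁ , x₂ +A y₂)

_·V_ : A → A² → A²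
s ·V (x₁ , x₂) = (s *A x₁ , s *A x₂)

IsBasis : A² → A² → Set
IsBasis u v =
  (w : A²) →
    ∃[ αβ ] ((proj₁ αβ ·V u) +V (proj₂ αβ ·V v) ≡ w)
  × (∀ (αβ αβ' : A × A) →
       (proj₁ αβ ·V u) +V (proj₂ αβ ·V v) ≡ w →
       (proj₁ αβ' ·V u) +V (proj₂ αβ' ·V v) ≡ w →
       αβ ≡ αβ')

-- The field K = ℚ(√-3) = ℚ(ρ); p + qρ is represented by (p , q).

K : Set
K = ℚ × ℚ

_*K_ : K → K → K
(a , b) *K (c , d) = (a ℚ.* c ℚ.- b ℚ.* d , a ℚ.* d ℚ.+ b ℚ.* c ℚ.+ b ℚ.* d)

-- complex conjugation: conj(ρ) = 1 - ρ, so conj(p + qρ) = (p + q) - qρ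
conj : K → K
conj (p , q) = (p ℚ.+ q , ℚ.- q)

-- N(p + qρ) = |p + qρ|² = p² + pq + q²
N : K → ℚ
N (p , q) = p ℚ.* p ℚ.+ p ℚ.* q ℚ.+ q ℚ.* q

-- Tr(z) = z + z̄ ; Tr(p + qρ) = 2p + q
Tr : K → ℚ
Tr (p , q) = p ℚ.+ p ℚ.+ q

ι : A → K
ι (m , n) = (m / 1 , n / 1)

-- Binary hermitian forms f(x,y) = a N(x) + c N(y) + ν x ȳ + ν̄ x̄ y,
-- given by their coefficients a, c ∈ ℚ, ν ∈ K.

record HermForm : Set where
  constructor herm
  field
    a : ℚ
    c : ℚ
    ν : K

open HermForm public

-- value of f at (x , y) ∈ K²  (ν x ȳ + ν̄ x̄ y = Tr(ν x ȳ))
evalK : HermForm → K → K → ℚ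
evalK f x y = a f ℚ.* N x ℚ.+ c f ℚ.* N y ℚ.+ Tr ((ν f *K x) *K conj y)

eval : HermForm → A² → ℚ
eval f (x , y) = evalK f (ι x) (ι y)

IsInteger : ℚ → Set
IsInteger q = ∃[ k ] (q ≡ k / 1)

Integral : HermForm → Set
Integral f = (w : A²) → IsInteger (eval f w)

-- discriminant Δ = -3 (ac - N(ν)), computed in the standard basis of A²
disc : HermForm → ℚ
disc f = (ℤ.- (+ 3)) / 1 ℚ.* (a f ℚ.* c f ℚ.- N (ν f))

ThreeDivides : ℚ → Set
ThreeDivides q = ∃[ k ] (q ≡ (+ 3 ℤ.* k) / 1)

inv : HermForm → A² → A² → ℕ → ℚ
inv f u v j =
  eval f u ℚ.+ eval f v ℚ.+ eval f (u +V (ρ^ j ·V v))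
    ℚ.+ eval f (u +V (ρ^ (suc j) ·V v))

-- Affine function L : ℂ → ℝ, written in the real coordinates (s , t) of
-- z = s + tρ:  L(z) = α + β s + γ t.  Evaluated at a point of A ⊆ ℂ.
affine : ℚ → ℚ → ℚ → A → ℚ
affine α β γ (s , t) = α ℚ.+ β ℚ.* (s / 1) ℚ.+ γ ℚ.* (t / 1)

{-# OPTIONS --safe #-}
module Submission where

-- Write p = f(u), q = f(v).  As f is hermitian, f(u + μv) = p + N(μ) q + ms + nt for
-- μ = m + nρ, with s and t its polar terms in the directions 1 and ρ.  The vertices
-- are units μ = ρʲ, so N(μ) = N(ρμ) = 1 and inv(vⱼ) = 3p + 3q + (s + t)m + (2t - s)n,
-- the value at ρʲ of an affine function L.  L is constant on the edge from μ to ρμ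
-- only if (2s - t)m + (s + t)n = 0, which forces 3 ∣ s + t because (n - m)² ≡ 1
-- (mod 3) for a unit.  Finally s² - st + t² - 3pq = N(det(u , v)) Δ where
-- N(det(u , v)) = 1 as (u , v) is a basis, and 3 ∣ s + t makes
-- s² - st + t² - 3pq = (s + t)² - 3(st + pq) divisible by 3.

open import Defs hiding (conj)
open import Data.Nat using (ℕ; zero; suc; _%_)
open import Data.Fin using (Fin; toℕ; zero; suc)
open import Data.Integer as ℤ using (ℤ; +_)
import Data.Integer.Properties as ℤP
import Data.Integer.Tactic.RingSolver as ℤ-Tactic
open import Data.Rational as ℚ using (ℚ; mkℚ; 0ℚ; 1ℚ)
import Data.Rational.Properties as ℚP
open import Data.Nat.Coprimality as Coprimality using (Coprime; 1-coprimeTo)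
open import Data.Product using (_×_; _,_; proj₁; proj₂; ∃-syntax)
open import Function using (_∘_)
open import Algebra.Bundles.Raw using (RawRing)
open import Algebra.Properties.CommutativeSemigroup ℤP.*-commutativeSemigroup using (x∙yz≈y∙xz)
open import Level using (0ℓ)
open import Relation.Binary.PropositionalEquality
  using (_≡_; _≢_; refl; sym; trans; cong; cong₂; subst; module ≡-Reasoning)
open import Relation.Nullary using (¬_)
open import Relation.Nullary.Decidable using (dec⇒maybe)
open import Tactic.RingSolver using (solve-∀)
open import Tactic.RingSolver.Core.AlmostCommutativeRing using (AlmostCommutativeRing; fromCommutativeRing)
open import Tactic.RingSolver.Core.Expression using (Expr; Κ; _⊕_; _⊗_; ⊝_)
import Tactic.RingSolver.NonReflective as NonReflective

-- Arithmetic of R[ρ] = R[X]/(X² - X + 1), with m + nρ written (m , n).  It is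
-- stated once over a raw ring so that the ring solver can be run on its
-- syntactic instance; over ℤ and ℚ the operations unfold to _*A_, _*K_, N, Tr,
-- conj and evalK of Defs.
module EisensteinArithmetic (R : RawRing 0ℓ 0ℓ) where
  open RawRing R

  infixl 6 _+ρ_ _-ρ_
  infixl 7 _*ρ_

  private
    infixl 6 _-_
    _-_ : Carrier → Carrier → Carrier
    x - y = x + - y

  one ρ : Carrier × Carrier
  one = (1# , 0#)
  ρ   = (0# , 1#)

  _+ρ_ _-ρ_ _*ρ_ : Carrier × Carrier → Carrier × Carrier → Carrier × Carrier
  (a , b) +ρ (c , d) = (a + c , b + d)
  (a , b) -ρ (c , d) = (a - c , b - d)
  (a , b) *ρ (c , d) = (a * c - b * d , a * d + b * c + b * d)

  norm trace : Carrier × Carrier → Carrier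
  norm (a , b) = a * a + a * b + b * b
  trace (a , b) = a + a + b

  conj : Carrier × Carrier → Carrier × Carrier
  conj (a , b) = (a + b , - b)

  det : (Carrier × Carrier) × (Carrier × Carrier) → (Carrier × Carrier) × (Carrier × Carrier) → Carrier × Carrier
  det (x , y) (z , w) = x *ρ w -ρ y *ρ z

  form : Carrier → Carrier → Carrier × Carrier → Carrier × Carrier → Carrier × Carrier → Carrier
  form a c ν x y = a * norm x + c * norm y + trace ((ν *ρ x) *ρ conj y)

  polar : Carrier → Carrier → Carrier × Carrier → (x y z w μ : Carrier × Carrier) → Carrier
  polar a c ν x y z w μ =
    form a c ν (x +ρ μ *ρ z) (y +ρ μ *ρ w) - form a c ν x y - norm μ * form a c ν z w


-- Opened only after EisensteinArithmetic, whose RawRing field names would clash.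
open import Data.Rational using (_+_; _*_; _-_; -_; _/_)
open ≡-Reasoning

ℚ-ring : AlmostCommutativeRing 0ℓ 0ℓ
ℚ-ring = fromCommutativeRing ℚP.+-*-commutativeRing (λ p → dec⇒maybe (0ℚ ℚ.≟ p))

module ℚ-Solver = NonReflective ℚ-ring
module ℤ-Solver = NonReflective ℤ-Tactic.ring

3ℚ : ℚ
3ℚ = + 3 / 1

expressionRawRing : (C : Set) → C → C → ℕ → RawRing 0ℓ 0ℓ
expressionRawRing C 0c 1c n = record
  { Carrier = Expr C n ; _≈_ = _≡_ ; _+_ = _⊕_ ; _*_ = _⊗_ ; -_ = ⊝_ ; 0# = Κ 0c ; 1# = Κ 1c }

module ℤ[ρ] = EisensteinArithmetic ℤ.+-*-rawRing
module ℚ[ρ] = EisensteinArithmetic ℚ.+-*-rawRing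
module ℤ[ρ]-Expr {n} = EisensteinArithmetic (expressionRawRing ℤ (+ 0) (+ 1) n)
module ℚ[ρ]-Expr {n} = EisensteinArithmetic (expressionRawRing ℚ 0ℚ 1ℚ n)

open ℚ[ρ]

norm-* : ∀ μ κ → norm (μ *ρ κ) ≡ norm μ * norm κ
norm-* (m , n) (k , l) =
  ℚ-Solver.solve 4 (λ m n k l → E.norm ((m , n) E.*ρ (k , l)) ℚ-Solver.⊜ E.norm (m , n) ⊗ E.norm (k , l))
    refl m n k l
  where module E = ℚ[ρ]-Expr

norm-ρ-* : ∀ μ → norm (ρ *ρ μ) ≡ norm μ
norm-ρ-* μ = trans (norm-* ρ μ) (ℚP.*-identityˡ (norm μ))

form-along-line : ∀ a c ν x y z w μ →
  form a c ν (x +ρ μ *ρ z) (y +ρ μ *ρ w) ≡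
    form a c ν x y + norm μ * form a c ν z w
      + (proj₁ μ * polar a c ν x y z w one + proj₂ μ * polar a c ν x y z w ρ)
form-along-line a c (ν₁ , ν₂) (x₁ , x₂) (y₁ , y₂) (z₁ , z₂) (w₁ , w₂) (m , n) =
  ℚ-Solver.solve 14
    (λ a c ν₁ ν₂ x₁ x₂ y₁ y₂ z₁ z₂ w₁ w₂ m n →
      let ν = (ν₁ , ν₂); x = (x₁ , x₂); y = (y₁ , y₂); z = (z₁ , z₂); w = (w₁ , w₂); μ = (m , n) in
      E.form a c ν (x E.+ρ μ E.*ρ z) (y E.+ρ μ E.*ρ w) ℚ-Solver.⊜
        (E.form a c ν x y ⊕ E.norm μ ⊗ E.form a c ν z w
          ⊕ (m ⊗ E.polar a c ν x y z w E.one ⊕ n ⊗ E.polar a c ν x y z w E.ρ)))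
    refl a c ν₁ ν₂ x₁ x₂ y₁ y₂ z₁ z₂ w₁ w₂ m n
  where module E = ℚ[ρ]-Expr

-- The left side is the discriminant of the form in the basis ((x , y) , (z , w)),
-- so this is the change-of-basis law for Δ.
disc-change-of-basis : ∀ a c ν x y z w →
  let p = form a c ν x y; q = form a c ν z w
      s = polar a c ν x y z w one; t = polar a c ν x y z w ρ
  in s * s - s * t + t * t - 3ℚ * p * q ≡ norm (det (x , y) (z , w)) * disc (herm a c ν)
disc-change-of-basis a c (ν₁ , ν₂) (x₁ , x₂) (y₁ , y₂) (z₁ , z₂) (w₁ , w₂) =
  ℚ-Solver.solve 12
    (λ a c ν₁ ν₂ x₁ x₂ y₁ y₂ z₁ z₂ w₁ w₂ →
      let ν = (ν₁ , ν₂); x = (x₁ , x₂); y = (y₁ , y₂); z = (z₁ , z₂); w = (w₁ , w₂)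
          p = E.form a c ν x y; q = E.form a c ν z w
          s = E.polar a c ν x y z w E.one; t = E.polar a c ν x y z w E.ρ
      in s ⊗ s ⊕ ⊝ (s ⊗ t) ⊕ t ⊗ t ⊕ ⊝ (Κ 3ℚ ⊗ p ⊗ q) ℚ-Solver.⊜
           E.norm (E.det (x , y) (z , w)) ⊗ (Κ (ℤ.- + 3 / 1) ⊗ (a ⊗ c ⊕ ⊝ E.norm ν)))
    refl a c ν₁ ν₂ x₁ x₂ y₁ y₂ z₁ z₂ w₁ w₂
  where module E = ℚ[ρ]-Expr

det-* : ∀ α β α′ β′ (u v : A²) →
  ℤ[ρ].det (α , β) (α′ , β′) *A ℤ[ρ].det u v ≡ ℤ[ρ].det ((α ·V u) +V (β ·V v)) ((α′ ·V u) +V (β′ ·V v))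
det-* (a₁ , a₂) (b₁ , b₂) (c₁ , c₂) (d₁ , d₂) ((x₁ , x₂) , (y₁ , y₂)) ((z₁ , z₂) , (w₁ , w₂)) =
  cong₂ _,_ (ℤ-Solver.solve 16 (λ a₁ a₂ b₁ b₂ c₁ c₂ d₁ d₂ x₁ x₂ y₁ y₂ z₁ z₂ w₁ w₂ →
                                   proj₁ (lhs a₁ a₂ b₁ b₂ c₁ c₂ d₁ d₂ x₁ x₂ y₁ y₂ z₁ z₂ w₁ w₂)
                                     ℤ-Solver.⊜ proj₁ (rhs a₁ a₂ b₁ b₂ c₁ c₂ d₁ d₂ x₁ x₂ y₁ y₂ z₁ z₂ w₁ w₂))
              refl a₁ a₂ b₁ b₂ c₁ c₂ d₁ d₂ x₁ x₂ y₁ y₂ z₁ z₂ w₁ w₂)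
            (ℤ-Solver.solve 16 (λ a₁ a₂ b₁ b₂ c₁ c₂ d₁ d₂ x₁ x₂ y₁ y₂ z₁ z₂ w₁ w₂ →
                                   proj₂ (lhs a₁ a₂ b₁ b₂ c₁ c₂ d₁ d₂ x₁ x₂ y₁ y₂ z₁ z₂ w₁ w₂)
                                     ℤ-Solver.⊜ proj₂ (rhs a₁ a₂ b₁ b₂ c₁ c₂ d₁ d₂ x₁ x₂ y₁ y₂ z₁ z₂ w₁ w₂))
              refl a₁ a₂ b₁ b₂ c₁ c₂ d₁ d₂ x₁ x₂ y₁ y₂ z₁ z₂ w₁ w₂)
  where
  module E {n} = ℤ[ρ]-Expr {n}
  lhs rhs : ∀ {n} → (a₁ a₂ b₁ b₂ c₁ c₂ d₁ d₂ x₁ x₂ y₁ y₂ z₁ z₂ w₁ w₂ : Expr ℤ n) → Expr ℤ n × Expr ℤ n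
  lhs a₁ a₂ b₁ b₂ c₁ c₂ d₁ d₂ x₁ x₂ y₁ y₂ z₁ z₂ w₁ w₂ =
    E.det ((a₁ , a₂) , (b₁ , b₂)) ((c₁ , c₂) , (d₁ , d₂)) E.*ρ E.det ((x₁ , x₂) , (y₁ , y₂)) ((z₁ , z₂) , (w₁ , w₂))
  rhs a₁ a₂ b₁ b₂ c₁ c₂ d₁ d₂ x₁ x₂ y₁ y₂ z₁ z₂ w₁ w₂ =
    let α = (a₁ , a₂); β = (b₁ , b₂); α′ = (c₁ , c₂); β′ = (d₁ , d₂)
        x = (x₁ , x₂); y = (y₁ , y₂); z = (z₁ , z₂); w = (w₁ , w₂)
    in E.det (α E.*ρ x E.+ρ β E.*ρ z , α E.*ρ y E.+ρ β E.*ρ w) (α′ E.*ρ x E.+ρ β′ E.*ρ z , α′ E.*ρ y E.+ρ β′ E.*ρ w)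

basis⇒det-unit : ∀ {u v} → IsBasis u v → ∃[ e ] e *A ℤ[ρ].det u v ≡ 1A
basis⇒det-unit {u} {v} basis with basis (1A , 0A) | basis (0A , 1A)
... | (α , β) , αu+βv≡e₁ , _ | (α′ , β′) , α′u+β′v≡e₂ , _ =
  ℤ[ρ].det (α , β) (α′ , β′) , trans (det-* α β α′ β′ u v) (cong₂ ℤ[ρ].det αu+βv≡e₁ α′u+β′v≡e₂)

coprime-1 : ∀ i → Coprime ℤ.∣ i ∣ 1
coprime-1 i = Coprimality.sym (1-coprimeTo ℤ.∣ i ∣)

/1≡mkℚ : ∀ i → i / 1 ≡ mkℚ i 0 (coprime-1 i)
/1≡mkℚ i = ℚP.↥p/↧p≡p (mkℚ i 0 (coprime-1 i))

/1-homo-+ : ∀ i j → (i ℤ.+ j) / 1 ≡ i / 1 + j / 1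
/1-homo-+ i j = begin
  (i ℤ.+ j) / 1                 ≡⟨ cong (_/ 1) (cong₂ ℤ._+_ (sym (ℤP.*-identityʳ i)) (sym (ℤP.*-identityʳ j))) ⟩
  (i ℤ.* + 1 ℤ.+ j ℤ.* + 1) / 1 ≡⟨ sym (cong₂ _+_ (/1≡mkℚ i) (/1≡mkℚ j)) ⟩
  i / 1 + j / 1                 ∎

/1-homo-* : ∀ i j → (i ℤ.* j) / 1 ≡ (i / 1) * (j / 1)
/1-homo-* i j = sym (cong₂ _*_ (/1≡mkℚ i) (/1≡mkℚ j))

/1-homo-neg : ∀ i → (ℤ.- i) / 1 ≡ - (i / 1)
/1-homo-neg i = trans (/1≡mkℚ (ℤ.- i)) (trans (neg-mkℚ i) (sym (cong -_ (/1≡mkℚ i))))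
  where
  neg-mkℚ : ∀ i → mkℚ (ℤ.- i) 0 (coprime-1 (ℤ.- i)) ≡ - mkℚ i 0 (coprime-1 i)
  neg-mkℚ (+ 0)       = refl
  neg-mkℚ (+ suc n)   = refl
  neg-mkℚ ℤ.-[1+ n ]  = refl

/1-homo-- : ∀ i j → (i ℤ.- j) / 1 ≡ i / 1 - j / 1
/1-homo-- i j = trans (/1-homo-+ i (ℤ.- j)) (cong (_+_ (i / 1)) (/1-homo-neg j))

ι-+ : ∀ μ κ → ι (μ +A κ) ≡ ι μ +ρ ι κ
ι-+ (m , n) (k , l) = cong₂ _,_ (/1-homo-+ m k) (/1-homo-+ n l)

ι-- : ∀ μ κ → ι (μ ℤ[ρ].-ρ κ) ≡ ι μ -ρ ι κ
ι-- (m , n) (k , l) = cong₂ _,_ (/1-homo-- m k) (/1-homo-- n l)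

ι-* : ∀ μ κ → ι (μ *A κ) ≡ ι μ *ρ ι κ
ι-* (m , n) (k , l) = cong₂ _,_
  (trans (/1-homo-- (m ℤ.* k) (n ℤ.* l)) (cong₂ _-_ (/1-homo-* m k) (/1-homo-* n l)))
  (begin
    (m ℤ.* l ℤ.+ n ℤ.* k ℤ.+ n ℤ.* l) / 1
      ≡⟨ trans (/1-homo-+ (m ℤ.* l ℤ.+ n ℤ.* k) (n ℤ.* l)) (cong (_+ (n ℤ.* l) / 1) (/1-homo-+ (m ℤ.* l) (n ℤ.* k))) ⟩
    (m ℤ.* l) / 1 + (n ℤ.* k) / 1 + (n ℤ.* l) / 1
      ≡⟨ cong₂ _+_ (cong₂ _+_ (/1-homo-* m l) (/1-homo-* n k)) (/1-homo-* n l) ⟩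
    (m / 1) * (l / 1) + (n / 1) * (k / 1) + (n / 1) * (l / 1) ∎)

ι-det : ∀ (u v : A²) → ι (ℤ[ρ].det u v) ≡ det (ι (proj₁ u) , ι (proj₂ u)) (ι (proj₁ v) , ι (proj₂ v))
ι-det (x , y) (z , w) = trans (ι-- (x *A w) (y *A z)) (cong₂ _-ρ_ (ι-* x w) (ι-* y z))

isInteger-+ : ∀ {x y} → IsInteger x → IsInteger y → IsInteger (x + y)
isInteger-+ (i , refl) (j , refl) = i ℤ.+ j , sym (/1-homo-+ i j)

isInteger-* : ∀ {x y} → IsInteger x → IsInteger y → IsInteger (x * y)
isInteger-* (i , refl) (j , refl) = i ℤ.* j , sym (/1-homo-* i j)

isInteger-neg : ∀ {x} → IsInteger x → IsInteger (- x)
isInteger-neg (i , refl) = ℤ.- i , sym (/1-homo-neg i)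

isInteger-- : ∀ {x y} → IsInteger x → IsInteger y → IsInteger (x - y)
isInteger-- x∈ℤ y∈ℤ = isInteger-+ x∈ℤ (isInteger-neg y∈ℤ)

isInteger-norm-ι : ∀ μ → IsInteger (norm (ι μ))
isInteger-norm-ι (m , n) = isInteger-+ (isInteger-+ (isInteger-* m∈ℤ m∈ℤ) (isInteger-* m∈ℤ n∈ℤ)) (isInteger-* n∈ℤ n∈ℤ)
  where
  m∈ℤ : IsInteger (m / 1)
  m∈ℤ = m , refl
  n∈ℤ : IsInteger (n / 1)
  n∈ℤ = n , refl

threeDivides : ∀ {x y} → IsInteger y → x ≡ 3ℚ * y → ThreeDivides x
threeDivides (k , refl) x≡3k = k , trans x≡3k (sym (/1-homo-* (+ 3) k))

threeDivides-*ˡ : ∀ {x y} → IsInteger x → ThreeDivides y → ThreeDivides (x * y)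
threeDivides-*ˡ (i , refl) (k , refl) =
  i ℤ.* k , trans (sym (/1-homo-* i (+ 3 ℤ.* k))) (cong (_/ 1) (x∙yz≈y∙xz i (+ 3) k))

norm-ι-ρ^ : ∀ j → norm (ι (ρ^ j)) ≡ 1ℚ
norm-ι-ρ^ zero    = refl
norm-ι-ρ^ (suc j) = begin
  norm (ι (ρA *A ρ^ j))  ≡⟨ cong norm (ι-* ρA (ρ^ j)) ⟩
  norm (ρ *ρ ι (ρ^ j))   ≡⟨ norm-ρ-* (ι (ρ^ j)) ⟩
  norm (ι (ρ^ j))        ≡⟨ norm-ι-ρ^ j ⟩
  1ℚ                     ∎

-- (0ℚ * m - 1ℚ * n , 0ℚ * n + 1ℚ * m + 1ℚ * n) is ρ *ρ (m , n) unfolded.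
vertex-pair-sum : ∀ p q s t m n →
  p + q + (p + q + (m * s + n * t)) + (p + q + ((0ℚ * m - 1ℚ * n) * s + (0ℚ * n + 1ℚ * m + 1ℚ * n) * t))
    ≡ p + p + p + q + q + q + (s + t) * m + (t + t - s) * n
vertex-pair-sum = solve-∀ ℚ-ring

-- The edge from m + nρ to its rotation ρ(m + nρ) changes the affine function by
-- d = (2s - t)m + (s + t)n; as 2s - t ≡ -(s + t) mod 3, d ≡ (s + t)(n - m), and
-- (n - m)² = N(m + nρ) - 3mn.
edge-residue : ∀ α s t m n →
  s + t ≡ 3ℚ * ((s + t) * m * n - s * m * (n - m))
    + ((α + (s + t) * m + (t + t - s) * n)
        - (α + (s + t) * (0ℚ * m - 1ℚ * n) + (t + t - s) * (0ℚ * n + 1ℚ * m + 1ℚ * n))) * (n - m)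
    + (s + t) * (1ℚ - (m * m + m * n + n * n))
edge-residue = solve-∀ ℚ-ring

residue-vanishes : ∀ r x k y → r + (y - y) * k + x * (1ℚ - 1ℚ) ≡ r
residue-vanishes = solve-∀ ℚ-ring

constant-edge⇒3∣ : ∀ α s t (μ : A) → IsInteger s → IsInteger t → norm (ι μ) ≡ 1ℚ →
  affine α (s + t) (t + t - s) μ ≡ affine α (s + t) (t + t - s) (ρA *A μ) → ThreeDivides (s + t)
constant-edge⇒3∣ α s t μ s∈ℤ t∈ℤ ∣μ∣≡1 flat = threeDivides r∈ℤ (begin
  s + t                                                   ≡⟨ edge-residue α s t m n ⟩
  3ℚ * r + (L (ι μ) - L (ρ *ρ ι μ)) * (n - m) + (s + t) * (1ℚ - norm (ι μ))
    ≡⟨ cong₂ (λ y N → 3ℚ * r + (L (ι μ) - y) * (n - m) + (s + t) * (1ℚ - N)) (sym flat′) ∣μ∣≡1 ⟩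
  3ℚ * r + (L (ι μ) - L (ι μ)) * (n - m) + (s + t) * (1ℚ - 1ℚ)
    ≡⟨ residue-vanishes (3ℚ * r) (s + t) (n - m) (L (ι μ)) ⟩
  3ℚ * r                                                  ∎)
  where
  m n r : ℚ
  m = proj₁ (ι μ)
  n = proj₂ (ι μ)
  r = (s + t) * m * n - s * m * (n - m)
  m∈ℤ : IsInteger m
  m∈ℤ = proj₁ μ , refl
  n∈ℤ : IsInteger n
  n∈ℤ = proj₂ μ , refl
  r∈ℤ : IsInteger r
  r∈ℤ = isInteger-- (isInteger-* (isInteger-* (isInteger-+ s∈ℤ t∈ℤ) m∈ℤ) n∈ℤ)
                    (isInteger-* (isInteger-* s∈ℤ m∈ℤ) (isInteger-- n∈ℤ m∈ℤ))
  L : K → ℚ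
  L κ = α + (s + t) * proj₁ κ + (t + t - s) * proj₂ κ
  flat′ : L (ι μ) ≡ L (ρ *ρ ι μ)
  flat′ = trans flat (cong L (ι-* ρA μ))

norm-form-as-square : ∀ s t p q → s * s - s * t + t * t - 3ℚ * p * q ≡ (s + t) * (s + t) - 3ℚ * (s * t + p * q)
norm-form-as-square = solve-∀ ℚ-ring

norm-form-of-multiple : ∀ k s t p q → 3ℚ * k * (3ℚ * k) - 3ℚ * (s * t + p * q) ≡ 3ℚ * (3ℚ * k * k - (s * t + p * q))
norm-form-of-multiple = solve-∀ ℚ-ring

3∣sum⇒3∣norm-form : ∀ {s t p q} → IsInteger s → IsInteger t → IsInteger p → IsInteger q →
  ThreeDivides (s + t) → ThreeDivides (s * s - s * t + t * t - 3ℚ * p * q)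
3∣sum⇒3∣norm-form {s} {t} {p} {q} s∈ℤ t∈ℤ p∈ℤ q∈ℤ (k , s+t≡3k) = threeDivides
  (isInteger-- (isInteger-* (isInteger-* (+ 3 , refl) (k , refl)) (k , refl))
               (isInteger-+ (isInteger-* s∈ℤ t∈ℤ) (isInteger-* p∈ℤ q∈ℤ)))
  (begin
    s * s - s * t + t * t - 3ℚ * p * q                  ≡⟨ norm-form-as-square s t p q ⟩
    (s + t) * (s + t) - 3ℚ * (s * t + p * q)
      ≡⟨ cong (λ x → x * x - 3ℚ * (s * t + p * q)) (trans s+t≡3k (/1-homo-* (+ 3) k)) ⟩
    3ℚ * (k / 1) * (3ℚ * (k / 1)) - 3ℚ * (s * t + p * q) ≡⟨ norm-form-of-multiple (k / 1) s t p q ⟩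
    3ℚ * (3ℚ * (k / 1) * (k / 1) - (s * t + p * q))      ∎)

module Hexagon (f : HermForm) (u v : A²) where

  x y z w : K
  x = ι (proj₁ u)
  y = ι (proj₂ u)
  z = ι (proj₁ v)
  w = ι (proj₂ v)

  p q s t : ℚ
  p = eval f u
  q = eval f v
  s = polar (a f) (c f) (ν f) x y z w one
  t = polar (a f) (c f) (ν f) x y z w ρ

  line : K → ℚ
  line μ = p + norm μ * q + (proj₁ μ * s + proj₂ μ * t)

  eval-on-line : ∀ μ → eval f (u +V (μ ·V v)) ≡ form (a f) (c f) (ν f) (x +ρ ι μ *ρ z) (y +ρ ι μ *ρ w)
  eval-on-line μ = cong₂ (form (a f) (c f) (ν f)) (ι-+-* (proj₁ u) (proj₁ v)) (ι-+-* (proj₂ u) (proj₂ v))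
    where
    ι-+-* : ∀ κ λ′ → ι (κ +A (μ *A λ′)) ≡ ι κ +ρ ι μ *ρ ι λ′
    ι-+-* κ λ′ = trans (ι-+ κ (μ *A λ′)) (cong (ι κ +ρ_) (ι-* μ λ′))

  eval-line : ∀ μ → eval f (u +V (μ ·V v)) ≡ line (ι μ)
  eval-line μ = trans (eval-on-line μ) (form-along-line (a f) (c f) (ν f) x y z w (ι μ))

  line-unit : ∀ μ → norm μ ≡ 1ℚ → line μ ≡ p + q + (proj₁ μ * s + proj₂ μ * t)
  line-unit μ ∣μ∣≡1 =
    cong (λ N → p + N + (proj₁ μ * s + proj₂ μ * t)) (trans (cong (_* q) ∣μ∣≡1) (ℚP.*-identityˡ q))

  α β γ : ℚ
  α = p + p + p + q + q + q
  β = s + t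
  γ = t + t - s

  inv-affine : ∀ j → inv f u v j ≡ affine α β γ (ρ^ j)
  inv-affine j = begin
    inv f u v j                                   ≡⟨ cong₂ (λ e e′ → p + q + e + e′) (eval-line μ) (eval-line (ρA *A μ)) ⟩
    p + q + line (ι μ) + line (ι (ρA *A μ))        ≡⟨ cong (λ κ → p + q + line (ι μ) + line κ) (ι-* ρA μ) ⟩
    p + q + line (ι μ) + line (ρ *ρ ι μ)          ≡⟨ cong₂ (λ e e′ → p + q + e + e′)
                                                      (line-unit (ι μ) (norm-ι-ρ^ j))
                                                      (line-unit (ρ *ρ ι μ) (trans (norm-ρ-* (ι μ)) (norm-ι-ρ^ j))) ⟩
    p + q + (p + q + (m * s + n * t))
      + (p + q + ((0ℚ * m - 1ℚ * n) * s + (0ℚ * n + 1ℚ * m + 1ℚ * n) * t)) ≡⟨ vertex-pair-sum p q s t m n ⟩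
    affine α β γ (ρ^ j)                           ∎
    where
    μ : A
    μ = ρ^ j
    m n : ℚ
    m = proj₁ (ι μ)
    n = proj₂ (ι μ)

  inv-wraps : (j : Fin 6) → inv f u v (suc (toℕ j) % 6) ≡ inv f u v (suc (toℕ j))
  inv-wraps zero                                = refl
  inv-wraps (suc zero)                          = refl
  inv-wraps (suc (suc zero))                    = refl
  inv-wraps (suc (suc (suc zero)))              = refl
  inv-wraps (suc (suc (suc (suc zero))))        = refl
  inv-wraps (suc (suc (suc (suc (suc zero))))) = refl

  δ : A
  δ = ℤ[ρ].det u v

  Δ[u,v] : ℚ
  Δ[u,v] = s * s - s * t + t * t - 3ℚ * p * q

  disc≡N[e]*Δ[u,v] : ∀ e → e *A δ ≡ 1A → disc f ≡ norm (ι e) * Δ[u,v]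
  disc≡N[e]*Δ[u,v] e e·δ≡1 = begin
    disc f                                             ≡⟨ sym (ℚP.*-identityˡ (disc f)) ⟩
    1ℚ * disc f                                        ≡⟨ cong (_* disc f) (sym N[e]·N[δ]≡1) ⟩
    norm (ι e) * norm (ι δ) * disc f                   ≡⟨ ℚP.*-assoc (norm (ι e)) (norm (ι δ)) (disc f) ⟩
    norm (ι e) * (norm (ι δ) * disc f)                 ≡⟨ cong (λ κ → norm (ι e) * (norm κ * disc f)) (ι-det u v) ⟩
    norm (ι e) * (norm (det (x , y) (z , w)) * disc f) ≡⟨ cong (norm (ι e) *_) (sym (disc-change-of-basis (a f) (c f) (ν f) x y z w)) ⟩
    norm (ι e) * Δ[u,v]                                ∎
    where
    N[e]·N[δ]≡1 : norm (ι e) * norm (ι δ) ≡ 1ℚ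
    N[e]·N[δ]≡1 = trans (sym (norm-* (ι e) (ι δ))) (trans (cong norm (sym (ι-* e δ))) (cong (norm ∘ ι) e·δ≡1))

  module _ (integral : Integral f) where

    polar-integral : ∀ μ → IsInteger (polar (a f) (c f) (ν f) x y z w (ι μ))
    polar-integral μ = subst IsInteger (cong (λ e → e - p - norm (ι μ) * q) (eval-on-line μ))
      (isInteger-- (isInteger-- (integral (u +V (μ ·V v))) (integral u)) (isInteger-* (isInteger-norm-ι μ) (integral v)))

    s∈ℤ : IsInteger s
    s∈ℤ = polar-integral 1A

    t∈ℤ : IsInteger t
    t∈ℤ = polar-integral ρA

    flat-edge⇒3∣ : ∀ j → inv f u v j ≡ inv f u v (suc j) → ThreeDivides (s + t)
    flat-edge⇒3∣ j flat = constant-edge⇒3∣ α s t (ρ^ j) s∈ℤ t∈ℤ (norm-ι-ρ^ j)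
      (trans (sym (inv-affine j)) (trans flat (inv-affine (suc j))))

    3∣disc : IsBasis u v → ThreeDivides (s + t) → ThreeDivides (disc f)
    3∣disc basis 3∣s+t =
      let e , e·δ≡1 = basis⇒det-unit basis
      in subst ThreeDivides (sym (disc≡N[e]*Δ[u,v] e e·δ≡1))
           (threeDivides-*ˡ (isInteger-norm-ι e) (3∣sum⇒3∣norm-form s∈ℤ t∈ℤ (integral u) (integral v) 3∣s+t))

lemma8p5 : (f : HermForm) → Integral f → (u v : A²) → IsBasis u v →
    (∃[ α ] ∃[ β ] ∃[ γ ] ((j : Fin 6) → affine α β γ (ρ^ (toℕ j)) ≡ inv f u v (toℕ j)))
    × (¬ ThreeDivides (disc f) → (j : Fin 6) → inv f u v (toℕ j) ≢ inv f u v (suc (toℕ j) % 6))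
lemma8p5 f integral u v basis =
  (α , β , γ , λ j → sym (inv-affine (toℕ j))) ,
  λ 3∤Δ j flat → 3∤Δ (3∣disc integral basis (flat-edge⇒3∣ integral (toℕ j) (trans flat (inv-wraps j))))
  where open Hexagon f u v
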